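{- Let $\mathcal{P}=\{V_{ij}:i,j\in[k]\}$ be a partition of a vertex set $V$ and let $\mathcal{Q}$ be a $\mathcal{P}$-balanced path system on $V$. Then the $\mathcal{Q}$-contracted partition of $\mathcal{P}$ is balanced.
   Context: $V_{i*}=\bigcup_jV_{ij}$, $V_{*i}=\bigcup_jV_{ji}$. A partition is balanced if $|V_{i*}|=|V_{*i}|$ for all $i$. A path system on $V$ is a set of vertex-disjoint directed paths with vertices in $V$, viewed as a digraph. A digraph $H$ on $V$ is $\mathcal{P}$-balanced if for all $i\in[k]$, $|V_{i*}|-|V_{*i}|=e_H(V_{i*},V)-e_H(V,V_{*i})$, where $e_H(A,B)$ is the number of edges of $H$ from $A$ to $B$. For a directed path $Q$ from $v_+\in V_{i_+j_+}$ to $v_-\in V_{i_-j_- }$, the $Q$-contracted partition is $\{V'_{ij}\}$ with $V'_{ij}=(V_{ij}\setminus V(Q))\cup\{w\}$ if $(i,j)=(i_-,j_+)$ and $V'_{ij}=V_{ij}\setminus V(Q)$ otherwise, where $w$ is a new vertex (replacing $Q$); the $\mathcal{Q}$-contracted partition is obtained by successively contracting every path of $\mathcal{Q}$. -}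

module Defs where

open import Data.Nat using (ℕ)
open import Data.Fin using (Fin)
open import Data.Fin.Properties using (_≟_)
open import Data.Integer using (ℤ; +_; _-_)
open import Data.List using (List; []; _∷_; _++_; length; filter; map; concatMap; allFin)
open import Data.List.NonEmpty using (List⁺; head; last; toList)
open import Data.List.Relation.Unary.Unique.Propositional using (Unique)
open import Data.Product using (_×_; _,_; proj₁; proj₂)
open import Data.Sum using (_⊎_; inj₁; inj₂)
open import Relation.Nullary using (¬?)
open import Relation.Binary.PropositionalEquality using (_≡_)
import Data.List.Membership.DecPropositional as DecMem

-- A partition P = {V_ij : i,j ∈ [k]} of the vertex set V = Fin n is given by
-- the map sending each vertex v to the unique (i , j) with v ∈ V_ij.
-- (Parts are allowed to be empty.)
Partition : ℕ → ℕ → Set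
Partition n k = Fin n → Fin k × Fin k

-- |V_{i*}| and |V_{*i}| for a partition whose vertex set is listed (without
-- repetitions) by vs, with part-labelling `part`.
rowSize : ∀ {A : Set} {k} → List A → (A → Fin k × Fin k) → Fin k → ℕ
rowSize vs part i = length (filter (λ v → proj₁ (part v) ≟ i) vs)

colSize : ∀ {A : Set} {k} → List A → (A → Fin k × Fin k) → Fin k → ℕ
colSize vs part i = length (filter (λ v → proj₂ (part v) ≟ i) vs)

BalancedOn : ∀ {A : Set} {k} → List A → (A → Fin k × Fin k) → Set
BalancedOn vs part = ∀ i → rowSize vs part i ≡ colSize vs part i

Balanced : ∀ {n k} → Partition n k → Set
Balanced {n} part = BalancedOn (allFin n) part

-- A directed path is a nonempty sequence of vertices v₀ v₁ … v_ℓ with edges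
-- v_t → v_{t+1}. A path system is a list of such paths, required to be
-- vertex-disjoint and each with distinct vertices.
PathSystem : ℕ → Set
PathSystem n = List (List⁺ (Fin n))

vertices : ∀ {n} → PathSystem n → List (Fin n)
vertices Q = concatMap toList Q

IsPathSystem : ∀ {n} → PathSystem n → Set
IsPathSystem Q = Unique (vertices Q)

seqEdges : ∀ {A : Set} → List A → List (A × A)
seqEdges [] = []
seqEdges (x ∷ []) = []
seqEdges (x ∷ y ∷ rest) = (x , y) ∷ seqEdges (y ∷ rest)

edges : ∀ {n} → PathSystem n → List (Fin n × Fin n)
edges Q = concatMap (λ p → seqEdges (toList p)) Q

eOut : ∀ {n k} → Partition n k → PathSystem n → Fin k → ℕ
eOut part Q i = length (filter (λ e → proj₁ (part (proj₁ e)) ≟ i) (edges Q))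

eIn : ∀ {n k} → Partition n k → PathSystem n → Fin k → ℕ
eIn part Q i = length (filter (λ e → proj₂ (part (proj₂ e)) ≟ i) (edges Q))

PBalanced : ∀ {n k} → Partition n k → PathSystem n → Set
PBalanced {n} part Q = ∀ i →
  (+ rowSize (allFin n) part i) - (+ colSize (allFin n) part i)
    ≡ (+ eOut part Q i) - (+ eIn part Q i)

-- Its vertex set consists of the old vertices not
-- on any path of Q (inj₁ v) together with one new vertex w per path (inj₂ p).
-- A path p from v₊ ∈ V_{i₊ j₊} to v₋ ∈ V_{i₋ j₋} is replaced by a new
-- vertex in V'_{i₋ j₊}.
ContrVertex : ℕ → Set
ContrVertex n = Fin n ⊎ List⁺ (Fin n)

contrVertices : ∀ {n} → PathSystem n → List (ContrVertex n)
contrVertices {n} Q =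
  map inj₁ (filter (λ v → ¬? (v ∈? vertices Q)) (allFin n)) ++ map inj₂ Q
  where open DecMem (_≟_ {n = n}) using (_∈?_)

contrPart : ∀ {n k} → Partition n k → ContrVertex n → Fin k × Fin k
contrPart part (inj₁ v) = part v
contrPart part (inj₂ p) = proj₁ (part (last p)) , proj₂ (part (head p))

ContractedBalanced : ∀ {n k} → Partition n k → PathSystem n → Set
ContractedBalanced part Q = BalancedOn (contrVertices Q) (contrPart part)

-- A path x₀ … x_ℓ of Q covers its vertices once as x₀ … x_{ℓ-1}
-- (the tails of its edges) plus x_ℓ, and once as x₁ … x_ℓ (the heads of its edges)
-- plus x₀. Hence |V_{i*}| = e_H(V_{i*},V) + |V'_{i*}| and |V_{*i}| = e_H(V,V_{*i}) + |V'_{*i}|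
-- for the contracted partition V', and P-balancedness cancels the edge counts.
module Submission where

open import Defs
open import Data.Nat using (ℕ; suc; _+_)
open import Level using (0ℓ)
open import Data.Integer using (ℤ; +_; _-_) renaming (_+_ to _+ℤ_)
import Data.Integer.Properties as ℤ
open import Data.Integer.Solver using (module +-*-Solver)
open import Data.Fin using (Fin)
open import Data.Fin.Properties using (_≟_)
open import Data.List
  using (List; []; _∷_; _++_; length; filter; map; concatMap; allFin; initLast; _∷ʳ′_)
open import Data.List.Properties using (filter-++; length-++; ++-assoc; map-concatMap)
open import Data.List.NonEmpty using (List⁺; head; last; toList) renaming (_∷_ to _∷⁺_)
open import Data.List.Membership.Propositional using (_∈_; _∉_)
open import Data.List.Membership.Propositional.Properties
  using (∈-allFin; ∈-filter⁺; ∈-filter⁻; ∈-++⁺ˡ; ∈-++⁺ʳ)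
open import Data.List.Membership.Propositional.Properties.WithK using (unique∧set⇒bag)
import Data.List.Membership.DecPropositional as DecMembership
open import Data.List.Relation.Binary.BagAndSetEquality using (_∼[_]_; set; ∼bag⇒↭)
open import Data.List.Relation.Binary.Permutation.Propositional
  using (_↭_; ↭-refl; ↭-prep; ↭-swap; ↭-trans; ↭-reflexive; module PermutationReasoning)
open import Data.List.Relation.Binary.Permutation.Propositional.Properties
  using (↭-length; filter-↭; ++⁺ˡ; ++⁺ʳ; shifts)
open import Data.List.Relation.Unary.Unique.Propositional using (Unique)
open import Data.List.Relation.Unary.Unique.Propositional.Properties using (allFin⁺; filter⁺; ++⁺)
open import Data.Product using (_×_; _,_; proj₁; proj₂)
open import Data.Sum using (inj₁; inj₂)
open import Function using (_∘_; mk⇔)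
open import Relation.Nullary using (Dec; ¬?; yes; no)
open import Relation.Unary using (Pred; Decidable)
open import Relation.Binary.PropositionalEquality
  using (_≡_; refl; sym; trans; cong; cong₂; module ≡-Reasoning)

count : ∀ {A : Set} {P : Pred A 0ℓ} → Decidable P → List A → ℕ
count P? xs = length (filter P? xs)

module _ {A : Set} {P : Pred A 0ℓ} (P? : Decidable P) where

  count-++ : ∀ xs ys → count P? (xs ++ ys) ≡ count P? xs + count P? ys
  count-++ xs ys = trans (cong length (filter-++ P? xs ys)) (length-++ (filter P? xs))

  count-↭ : ∀ {xs ys} → xs ↭ ys → count P? xs ≡ count P? ys
  count-↭ = ↭-length ∘ filter-↭ P?

  count-map : ∀ {B : Set} (f : B → A) xs → count P? (map f xs) ≡ count (P? ∘ f) xs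
  count-map f []       = refl
  count-map f (x ∷ xs) with P? (f x)
  ... | yes _ = cong suc (count-map f xs)
  ... | no  _ = count-map f xs

+-cancel-differences : ∀ (m n x y : ℤ) → (m +ℤ x) - (n +ℤ y) ≡ x - y → m ≡ n
+-cancel-differences m n x y eq = begin
  m                                       ≡⟨ isolate m n x y ⟩
  ((m +ℤ x) - (n +ℤ y)) - (x - y) +ℤ n   ≡⟨ cong (λ d → d - (x - y) +ℤ n) eq ⟩
  (x - y) - (x - y) +ℤ n                 ≡⟨ cancel (x - y) n ⟩
  n                                       ∎
  where
  open ≡-Reasoning
  open +-*-Solver
  isolate : ∀ m n x y → m ≡ ((m +ℤ x) - (n +ℤ y)) - (x - y) +ℤ n
  isolate = solve 4 (λ m n x y → m := ((m :+ x) :- (n :+ y)) :- (x :- y) :+ n) refl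
  cancel : ∀ d n → d - d +ℤ n ≡ n
  cancel = solve 2 (λ d n → d :- d :+ n := n) refl

-- `last` is computed through `initLast` of the tail, so it reduces once that is split.
last-∷ : ∀ {A : Set} (x y : A) ys → last (x ∷⁺ y ∷ ys) ≡ last (y ∷⁺ ys)
last-∷ x y ys with initLast ys
... | []       = refl
... | _ ∷ʳ′ _ = refl

∷-↭-last∷edgeTails : ∀ {A : Set} (x : A) xs →
  x ∷ xs ↭ last (x ∷⁺ xs) ∷ map proj₁ (seqEdges (x ∷ xs))
∷-↭-last∷edgeTails x []       = ↭-refl
∷-↭-last∷edgeTails x (y ∷ ys) = begin
  x ∷ y ∷ ys                        ↭⟨ ↭-prep x (∷-↭-last∷edgeTails y ys) ⟩
  x ∷ last (y ∷⁺ ys) ∷ tails        ↭⟨ ↭-swap x _ ↭-refl ⟩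
  last (y ∷⁺ ys) ∷ x ∷ tails        ≡⟨ cong (_∷ x ∷ tails) (sym (last-∷ x y ys)) ⟩
  last (x ∷⁺ y ∷ ys) ∷ x ∷ tails    ∎
  where
  open PermutationReasoning
  tails : List _
  tails = map proj₁ (seqEdges (y ∷ ys))

map-proj₂-seqEdges : ∀ {A : Set} (x : A) xs → map proj₂ (seqEdges (x ∷ xs)) ≡ xs
map-proj₂-seqEdges x []       = refl
map-proj₂-seqEdges x (y ∷ ys) = cong (y ∷_) (map-proj₂-seqEdges y ys)

toList≡head∷edgeHeads : ∀ {A : Set} (p : List⁺ A) →
  toList p ≡ head p ∷ map proj₂ (seqEdges (toList p))
toList≡head∷edgeHeads (x ∷⁺ xs) = cong (x ∷_) (sym (map-proj₂-seqEdges x xs))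

concatMap-↭-map++concatMap : ∀ {A B : Set} {h f : A → List B} {g : A → B} →
  (∀ x → h x ↭ g x ∷ f x) → ∀ xs → concatMap h xs ↭ map g xs ++ concatMap f xs
concatMap-↭-map++concatMap h↭g∷f []       = ↭-refl
concatMap-↭-map++concatMap {h = h} {f} {g} h↭g∷f (x ∷ xs) = begin
  h x ++ concatMap h xs                    ↭⟨ ++⁺ʳ _ (h↭g∷f x) ⟩
  g x ∷ f x ++ concatMap h xs              ↭⟨ ↭-prep (g x) (++⁺ˡ (f x) ih) ⟩
  g x ∷ f x ++ map g xs ++ concatMap f xs  ↭⟨ ↭-prep (g x) (shifts (f x) (map g xs)) ⟩
  g x ∷ map g xs ++ f x ++ concatMap f xs  ∎
  where
  open PermutationReasoning
  ih : concatMap h xs ↭ map g xs ++ concatMap f xs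
  ih = concatMap-↭-map++concatMap h↭g∷f xs

module _ {n : ℕ} where
  open DecMembership (_≟_ {n = n}) using (_∈?_)

  free? : (Q : PathSystem n) → Decidable (_∉ vertices Q)
  free? Q v = ¬? (v ∈? vertices Q)

  freeVertices : PathSystem n → List (Fin n)
  freeVertices Q = filter (free? Q) (allFin n)

  allFin-↭-free++vertices : (Q : PathSystem n) → IsPathSystem Q →
    allFin n ↭ freeVertices Q ++ vertices Q
  allFin-↭-free++vertices Q unique =
    ∼bag⇒↭ (unique∧set⇒bag (allFin⁺ n) uniqueRhs sameElements)
    where
    uniqueRhs : Unique (freeVertices Q ++ vertices Q)
    uniqueRhs = ++⁺ (filter⁺ (free? Q) (allFin⁺ n)) unique
      (λ (free , onPath) → proj₂ (∈-filter⁻ (free? Q) {xs = allFin n} free) onPath)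
    sameElements : allFin n ∼[ set ] (freeVertices Q ++ vertices Q)
    sameElements {v} = mk⇔ (λ _ → split (v ∈? vertices Q)) (λ _ → ∈-allFin v)
      where
      split : Dec (v ∈ vertices Q) → v ∈ freeVertices Q ++ vertices Q
      split (yes onPath) = ∈-++⁺ʳ (freeVertices Q) onPath
      split (no notOnPath) = ∈-++⁺ˡ (∈-filter⁺ (free? Q) (∈-allFin v) notOnPath)

  vertices-↭-lasts++edgeTails : (Q : PathSystem n) →
    vertices Q ↭ map last Q ++ map proj₁ (edges Q)
  vertices-↭-lasts++edgeTails Q = begin
    concatMap toList Q
      ↭⟨ concatMap-↭-map++concatMap (λ (x ∷⁺ xs) → ∷-↭-last∷edgeTails x xs) Q ⟩
    map last Q ++ concatMap (map proj₁ ∘ seqEdges ∘ toList) Q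
      ≡⟨ cong (map last Q ++_) (sym (map-concatMap proj₁ (seqEdges ∘ toList) Q)) ⟩
    map last Q ++ map proj₁ (edges Q) ∎
    where open PermutationReasoning

  vertices-↭-heads++edgeHeads : (Q : PathSystem n) →
    vertices Q ↭ map head Q ++ map proj₂ (edges Q)
  vertices-↭-heads++edgeHeads Q = begin
    concatMap toList Q
      ↭⟨ concatMap-↭-map++concatMap (↭-reflexive ∘ toList≡head∷edgeHeads) Q ⟩
    map head Q ++ concatMap (map proj₂ ∘ seqEdges ∘ toList) Q
      ≡⟨ cong (map head Q ++_) (sym (map-concatMap proj₂ (seqEdges ∘ toList) Q)) ⟩
    map head Q ++ map proj₂ (edges Q) ∎
    where open PermutationReasoning

  count-allFin : {P : Pred (Fin n) 0ℓ} (P? : Decidable P) (Q : PathSystem n) →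
    IsPathSystem Q → (end : List⁺ (Fin n) → Fin n) (edgeEnd : Fin n × Fin n → Fin n) →
    vertices Q ↭ map end Q ++ map edgeEnd (edges Q) →
    count P? (allFin n)
      ≡ (count P? (freeVertices Q) + count (P? ∘ end) Q) + count (P? ∘ edgeEnd) (edges Q)
  count-allFin P? Q isPathSystem end edgeEnd vertices↭ = begin
    count P? (allFin n)
      ≡⟨ count-↭ P? (↭-trans (allFin-↭-free++vertices Q isPathSystem) (++⁺ˡ F vertices↭)) ⟩
    count P? (F ++ ends ++ edgeEnds)
      ≡⟨ cong (count P?) (sym (++-assoc F ends edgeEnds)) ⟩
    count P? ((F ++ ends) ++ edgeEnds)
      ≡⟨ count-++ P? (F ++ ends) edgeEnds ⟩
    count P? (F ++ ends) + count P? edgeEnds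
      ≡⟨ cong₂ _+_ (count-++ P? F ends) (count-map P? edgeEnd (edges Q)) ⟩
    (count P? F + count P? ends) + count (P? ∘ edgeEnd) (edges Q)
      ≡⟨ cong (λ c → (count P? F + c) + count (P? ∘ edgeEnd) (edges Q)) (count-map P? end Q) ⟩
    (count P? F + count (P? ∘ end) Q) + count (P? ∘ edgeEnd) (edges Q) ∎
    where
    open ≡-Reasoning
    F ends edgeEnds : List (Fin n)
    F = freeVertices Q
    ends = map end Q
    edgeEnds = map edgeEnd (edges Q)

  count-contrVertices : {P : Pred (ContrVertex n) 0ℓ} (P? : Decidable P) (Q : PathSystem n) →
    count P? (contrVertices Q) ≡ count (P? ∘ inj₁) (freeVertices Q) + count (P? ∘ inj₂) Q
  count-contrVertices P? Q =
    trans (count-++ P? (map inj₁ (freeVertices Q)) (map inj₂ Q))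
          (cong₂ _+_ (count-map P? inj₁ (freeVertices Q)) (count-map P? inj₂ Q))

proposition5p3 : (n k : ℕ) (part : Partition n k) (Q : PathSystem n) →
    IsPathSystem Q → PBalanced part Q → ContractedBalanced part Q
proposition5p3 n k part Q isPathSystem pBalanced i =
  ℤ.+-injective (+-cancel-differences (+ rowC) (+ colC) (+ eOut part Q i) (+ eIn part Q i) (begin
    (+ rowC +ℤ + eOut part Q i) - (+ colC +ℤ + eIn part Q i)
      ≡⟨ cong₂ _-_ (sym (ℤ.pos-+ rowC _)) (sym (ℤ.pos-+ colC _)) ⟩
    + (rowC + eOut part Q i) - + (colC + eIn part Q i)
      ≡⟨ cong₂ (λ r c → + r - + c) (sym rowSize-allFin) (sym colSize-allFin) ⟩
    + rowSize (allFin n) part i - + colSize (allFin n) part i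
      ≡⟨ pBalanced i ⟩
    + eOut part Q i - + eIn part Q i ∎))
  where
  open ≡-Reasoning
  rowC colC : ℕ
  rowC = rowSize (contrVertices Q) (contrPart part) i
  colC = colSize (contrVertices Q) (contrPart part) i
  -- The contracted part of a path p is (row of last p , column of head p), so the first
  -- two summands of count-allFin are those of count-contrVertices by definition.
  rowSize-allFin : rowSize (allFin n) part i ≡ rowC + eOut part Q i
  rowSize-allFin = trans
    (count-allFin (λ v → proj₁ (part v) ≟ i) Q isPathSystem last proj₁
      (vertices-↭-lasts++edgeTails Q))
    (cong (_+ eOut part Q i)
      (sym (count-contrVertices (λ w → proj₁ (contrPart part w) ≟ i) Q)))
  colSize-allFin : colSize (allFin n) part i ≡ colC + eIn part Q i
  colSize-allFin = trans
    (count-allFin (λ v → proj₂ (part v) ≟ i) Q isPathSystem head proj₂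
      (vertices-↭-heads++edgeHeads Q))
    (cong (_+ eIn part Q i)
      (sym (count-contrVertices (λ w → proj₂ (contrPart part w) ≟ i) Q)))
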